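{- Let $H$ be a finite bigraph with colour classes $X$ and $Y$. Then $H$ is a cocomparability bigraph if and only if $H^{++}$ is a strong cocomparability graph.
   Context: $H^{++}$ is the reflexive graph obtained from $H$ by making each of $X$ and $Y$ a clique and adding a loop at each vertex. The Slash matrix is $\begin{bmatrix}0&1\\1&0\end{bmatrix}$; a matrix contains it as a submatrix if there are rows $i<j$ and columns $k<l$ with entries $(i,k)=0,(i,l)=1,(j,k)=1,(j,l)=0$. $H$ is a cocomparability bigraph if its biadjacency matrix (rows indexed by $X$, columns by $Y$) admits independent row and column permutations yielding a matrix not containing the Slash matrix. A reflexive graph is a strong cocomparability graph if its adjacency matrix (with 1's on the diagonal) has a simultaneous row-and-column permutation not containing the Slash matrix. -}

module Defs where

open import Data.Nat using (ℕ; _+_)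
open import Data.Fin using (Fin; _<_; splitAt)
open import Data.Bool using (Bool; true; false)
open import Data.Sum using (_⊎_; inj₁; inj₂)
open import Data.Product using (Σ; _×_; ∃; _,_)
open import Relation.Binary.PropositionalEquality using (_≡_)
open import Relation.Nullary using (¬_)
open import Function.Bundles using (_↔_; Inverse)

Matrix : ℕ → ℕ → Set
Matrix r c = Fin r → Fin c → Bool

ContainsSlash : ∀ {r c} → Matrix r c → Set
ContainsSlash {r} {c} M =
  Σ (Fin r) λ i → Σ (Fin r) λ j → Σ (Fin c) λ k → Σ (Fin c) λ l →
    (i < j) × (k < l) ×
    (M i k ≡ false) × (M i l ≡ true) × (M j k ≡ true) × (M j l ≡ false)

permute : ∀ {r c} → (Fin r ↔ Fin r) → (Fin c ↔ Fin c) → Matrix r c → Matrix r c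
permute σ τ M a b = M (Inverse.to σ a) (Inverse.to τ b)

-- A finite bigraph H with colour classes X = Fin m and Y = Fin n is given by its
-- biadjacency matrix (rows indexed by X, columns by Y).
Bigraph : ℕ → ℕ → Set
Bigraph m n = Matrix m n

IsCocomparabilityBigraph : ∀ {m n} → Bigraph m n → Set
IsCocomparabilityBigraph {m} {n} B =
  Σ (Fin m ↔ Fin m) λ σ → Σ (Fin n ↔ Fin n) λ τ → ¬ ContainsSlash (permute σ τ B)

record ReflexiveGraph (v : ℕ) : Set where
  field
    adj   : Matrix v v
    sym   : ∀ a b → adj a b ≡ adj b a
    refl  : ∀ a → adj a a ≡ true
open ReflexiveGraph public

IsStrongCocomparability : ∀ {v} → ReflexiveGraph v → Set
IsStrongCocomparability {v} G =
  Σ (Fin v ↔ Fin v) λ σ → ¬ ContainsSlash (permute σ σ (adj G))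

-- Adjacency of H⁺⁺ on vertex set X ⊎ Y ≅ Fin (m + n) (first m vertices are X):
-- X and Y are cliques, every vertex has a loop, and the X–Y edges are those of H.
plusplusAdj : ∀ {m n} → Bigraph m n → Matrix (m + n) (m + n)
plusplusAdj {m} {n} B a b with splitAt m a | splitAt m b
... | inj₁ x  | inj₁ x' = true
... | inj₂ y  | inj₂ y' = true
... | inj₁ x  | inj₂ y  = B x y
... | inj₂ y  | inj₁ x  = B x y

plusplusSym : ∀ {m n} (B : Bigraph m n) a b → plusplusAdj B a b ≡ plusplusAdj B b a
plusplusSym {m} B a b with splitAt m a | splitAt m b
... | inj₁ x  | inj₁ x' = Relation.Binary.PropositionalEquality.refl
... | inj₂ y  | inj₂ y' = Relation.Binary.PropositionalEquality.refl
... | inj₁ x  | inj₂ y  = Relation.Binary.PropositionalEquality.refl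
... | inj₂ y  | inj₁ x  = Relation.Binary.PropositionalEquality.refl

plusplusRefl : ∀ {m n} (B : Bigraph m n) a → plusplusAdj B a a ≡ true
plusplusRefl {m} B a with splitAt m a
... | inj₁ x = Relation.Binary.PropositionalEquality.refl
... | inj₂ y = Relation.Binary.PropositionalEquality.refl

_⁺⁺ : ∀ {m n} → Bigraph m n → ReflexiveGraph (m + n)
B ⁺⁺ = record { adj = plusplusAdj B ; sym = plusplusSym B ; refl = plusplusRefl B }

-- Forward: list X before Y, each in its Slash-free order. The two 0-entries of a Slash
-- of H⁺⁺ are non-edges, hence join X to Y since X and Y are cliques; as every X-vertex
-- precedes every Y-vertex, the Slash is then a Slash of H or of its transpose.
-- Backward: restricting a Slash-free ordering of H⁺⁺ to X (rows) and Y (columns) gives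
-- orders in which the biadjacency matrix of H is a submatrix of the reordered adjacency
-- matrix of H⁺⁺, and submatrices of Slash-free matrices are Slash-free. These orders are
-- realised as permutations of Fin m and Fin n by ranking.
module Submission where

open import Data.Nat using (ℕ)
open import Function.Bundles using (_⇔_)
open import Defs hiding (sym; refl)

open import Data.Bool using (true)
open import Data.Fin using (Fin; zero; suc; toℕ; fromℕ<; splitAt; _↑ˡ_; _↑ʳ_; punchOut; _<_; _<?_)
open import Data.Fin.Properties
  using (any?; _≟_; punchOut-injective; injective⇒≤; toℕ<n; toℕ-↑ˡ; toℕ-↑ʳ; toℕ-fromℕ<;
         ↑ˡ-injective; ↑ʳ-injective; splitAt-↑ˡ; splitAt-↑ʳ; splitAt⁻¹-↑ˡ; splitAt⁻¹-↑ʳ;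
         +↔⊎; <-irrefl; <-asym; <-trans; <-cmp; <⇒≢)
import Data.Nat as ℕ
import Data.Nat.Properties as ℕ
open import Data.Product using (Σ; ∃; _,_; proj₁; proj₂)
open import Data.Sum using (inj₁; inj₂)
open import Data.Sum.Function.Propositional using (_⊎-↔_)
open import Data.Unit using (tt)
open import Level using (Level)
open import Function using (_∘_; id)
open import Function.Bundles using (_↔_; Inverse; Injection; mk↔ₛ′; mk⇔)
open import Function.Properties.Inverse using (↔⇒↣)
open import Function.Construct.Composition using (_↔-∘_)
open import Function.Construct.Symmetry using (↔-sym)
open import Function.Definitions using (Injective)
open import Relation.Binary.Core using (_Preserves_⟶_)
open import Relation.Binary.Definitions using (tri<; tri≈; tri>)
open import Relation.Binary.PropositionalEquality
  using (_≡_; _≢_; refl; sym; trans; cong; cong₂; subst; subst₂)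
open import Relation.Nullary using (¬_; yes; no; contradiction)
open import Relation.Unary using (Pred; Decidable; _⊆_)

private variable
  ℓ ℓ′ : Level
  m n N : ℕ

count : {P : Pred (Fin n) ℓ} → Decidable P → ℕ
count {n = ℕ.zero}  P? = 0
count {n = ℕ.suc n} P? with P? zero
... | yes _ = ℕ.suc (count (P? ∘ suc))
... | no _  = count (P? ∘ suc)

count-⊆ : {P : Pred (Fin n) ℓ} {Q : Pred (Fin n) ℓ′} (P? : Decidable P) (Q? : Decidable Q) →
          P ⊆ Q → count P? ℕ.≤ count Q?
count-⊆ {n = ℕ.zero}  P? Q? P⊆Q = ℕ.z≤n
count-⊆ {n = ℕ.suc n} P? Q? P⊆Q with P? zero | Q? zero
... | yes _  | yes _  = ℕ.s≤s (count-⊆ (P? ∘ suc) (Q? ∘ suc) P⊆Q)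
... | yes p  | no ¬q  = contradiction (P⊆Q p) ¬q
... | no _   | yes _  = ℕ.m≤n⇒m≤1+n (count-⊆ (P? ∘ suc) (Q? ∘ suc) P⊆Q)
... | no _   | no _   = count-⊆ (P? ∘ suc) (Q? ∘ suc) P⊆Q

count-⊂ : {P : Pred (Fin n) ℓ} {Q : Pred (Fin n) ℓ′} (P? : Decidable P) (Q? : Decidable Q) →
          P ⊆ Q → ∀ z → ¬ P z → Q z → count P? ℕ.< count Q?
count-⊂ P? Q? P⊆Q zero ¬pz qz with P? zero | Q? zero
... | yes pz | _      = contradiction pz ¬pz
... | _      | no ¬qz = contradiction qz ¬qz
... | no _   | yes _  = ℕ.s≤s (count-⊆ (P? ∘ suc) (Q? ∘ suc) P⊆Q)
count-⊂ P? Q? P⊆Q (suc z) ¬pz qz with P? zero | Q? zero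
... | yes _ | yes _ = ℕ.s≤s (count-⊂ (P? ∘ suc) (Q? ∘ suc) P⊆Q z ¬pz qz)
... | yes p | no ¬q = contradiction (P⊆Q p) ¬q
... | no _  | yes _ = ℕ.m≤n⇒m≤1+n (count-⊂ (P? ∘ suc) (Q? ∘ suc) P⊆Q z ¬pz qz)
... | no _  | no _  = count-⊂ (P? ∘ suc) (Q? ∘ suc) P⊆Q z ¬pz qz

count-⊤ : ∀ n → count {n = n} (λ _ → yes tt) ≡ n
count-⊤ ℕ.zero    = refl
count-⊤ (ℕ.suc n) = cong ℕ.suc (count-⊤ n)

count-≢⊤ : {P : Pred (Fin n) ℓ} (P? : Decidable P) → ∀ z → ¬ P z → count P? ℕ.< n
count-≢⊤ {n = n} P? z ¬pz =
  subst (count P? ℕ.<_) (count-⊤ n) (count-⊂ P? (λ _ → yes tt) (λ _ → tt) z ¬pz tt)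

injective⇒surjective : (f : Fin n → Fin n) → Injective _≡_ _≡_ f → ∀ y → ∃ λ x → f x ≡ y
injective⇒surjective {n = ℕ.suc n} f f-injective y with any? (λ x → f x ≟ y)
... | yes hit = hit
... | no miss = contradiction (injective⇒≤ f′-injective) ℕ.1+n≰n
  where
  y≢f : ∀ x → y ≢ f x
  y≢f x y≡fx = miss (x , sym y≡fx)

  f′ : Fin (ℕ.suc n) → Fin n
  f′ x = punchOut (y≢f x)

  f′-injective : Injective _≡_ _≡_ f′
  f′-injective {x} {x′} = f-injective ∘ punchOut-injective (y≢f x) (y≢f x′)

module _ (p : Fin m → Fin N) (p-injective : Injective _≡_ _≡_ p) where
  private
    rank : Fin m → Fin m
    rank x = fromℕ< (count-≢⊤ (λ x′ → p x′ <? p x) x (<-irrefl refl))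

    rank-< : ∀ {x y} → p x < p y → rank x < rank y
    rank-< {x} {y} px<py = subst₂ ℕ._<_ (sym (toℕ-fromℕ< _)) (sym (toℕ-fromℕ< _))
      (count-⊂ (λ z → p z <? p x) (λ z → p z <? p y)
               (λ pz<px → <-trans pz<px px<py) x (<-irrefl refl) px<py)

    rank-injective : Injective _≡_ _≡_ rank
    rank-injective {x} {y} rx≡ry with <-cmp (p x) (p y)
    ... | tri< px<py _ _ = contradiction rx≡ry (<⇒≢ (rank-< px<py))
    ... | tri≈ _ px≡py _ = p-injective px≡py
    ... | tri> _ _ py<px = contradiction (sym rx≡ry) (<⇒≢ (rank-< py<px))

    rank-reflects-< : ∀ {x y} → rank x < rank y → p x < p y
    rank-reflects-< {x} {y} rx<ry with <-cmp (p x) (p y)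
    ... | tri< px<py _ _ = px<py
    ... | tri≈ _ px≡py _ = contradiction (cong rank (p-injective px≡py)) (<⇒≢ rx<ry)
    ... | tri> _ _ py<px = contradiction rx<ry (<-asym (rank-< py<px))

    unrank : Fin m → Fin m
    unrank i = proj₁ (injective⇒surjective rank rank-injective i)

    rank-unrank : ∀ i → rank (unrank i) ≡ i
    rank-unrank i = proj₂ (injective⇒surjective rank rank-injective i)

  sortBy : Σ (Fin m ↔ Fin m) λ π → (p ∘ Inverse.to π) Preserves _<_ ⟶ _<_
  sortBy = mk↔ₛ′ unrank rank (λ x → rank-injective (rank-unrank (rank x))) rank-unrank
         , λ {i} {j} i<j → rank-reflects-<
             (subst₂ _<_ (sym (rank-unrank i)) (sym (rank-unrank j)) i<j)

submatrix-slash : ∀ {r c r′ c′} (M : Matrix r c) (M′ : Matrix r′ c′)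
                  (f : Fin r′ → Fin r) (g : Fin c′ → Fin c) →
                  f Preserves _<_ ⟶ _<_ → g Preserves _<_ ⟶ _<_ →
                  (∀ a b → M′ a b ≡ M (f a) (g b)) →
                  ContainsSlash M′ → ContainsSlash M
submatrix-slash M M′ f g f-mono g-mono M′≡M (i , j , k , l , i<j , k<l , ik , il , jk , jl) =
  f i , f j , g k , g l , f-mono i<j , g-mono k<l ,
  trans (sym (M′≡M i k)) ik , trans (sym (M′≡M i l)) il ,
  trans (sym (M′≡M j k)) jk , trans (sym (M′≡M j l)) jl

data Side (m n : ℕ) : Fin (m ℕ.+ n) → Set where
  inX : (x : Fin m) → Side m n (x ↑ˡ n)
  inY : (y : Fin n) → Side m n (m ↑ʳ y)

side : ∀ m n (a : Fin (m ℕ.+ n)) → Side m n a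
side m n a with splitAt m a in eq
... | inj₁ x = subst (Side m n) (splitAt⁻¹-↑ˡ eq) (inX x)
... | inj₂ y = subst (Side m n) (splitAt⁻¹-↑ʳ eq) (inY y)

↑ʳ≮↑ˡ : ∀ (x : Fin m) (y : Fin n) → ¬ m ↑ʳ y < x ↑ˡ n
↑ʳ≮↑ˡ {m} {n} x y y<x = ℕ.<⇒≱ (subst₂ ℕ._<_ (toℕ-↑ʳ m y) (toℕ-↑ˡ x n) y<x)
  (ℕ.≤-trans (ℕ.<⇒≤ (toℕ<n x)) (ℕ.m≤m+n m (toℕ y)))

↑ˡ-cancel-< : ∀ {x x′ : Fin m} → x ↑ˡ n < x′ ↑ˡ n → x < x′
↑ˡ-cancel-< {n = n} {x} {x′} = subst₂ ℕ._<_ (toℕ-↑ˡ x n) (toℕ-↑ˡ x′ n)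

↑ʳ-cancel-< : ∀ {y y′ : Fin n} → m ↑ʳ y < m ↑ʳ y′ → y < y′
↑ʳ-cancel-< {m = m} {y} {y′} = ℕ.+-cancelˡ-< m _ _ ∘ subst₂ ℕ._<_ (toℕ-↑ʳ m y) (toℕ-↑ʳ m y′)

module _ (B : Bigraph m n) where

  ⁺⁺-XX : ∀ x x′ → plusplusAdj B (x ↑ˡ n) (x′ ↑ˡ n) ≡ true
  ⁺⁺-XX x x′ rewrite splitAt-↑ˡ m x n | splitAt-↑ˡ m x′ n = refl

  ⁺⁺-YY : ∀ y y′ → plusplusAdj B (m ↑ʳ y) (m ↑ʳ y′) ≡ true
  ⁺⁺-YY y y′ rewrite splitAt-↑ʳ m n y | splitAt-↑ʳ m n y′ = refl

  ⁺⁺-XY : ∀ x y → plusplusAdj B (x ↑ˡ n) (m ↑ʳ y) ≡ B x y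
  ⁺⁺-XY x y rewrite splitAt-↑ˡ m x n | splitAt-↑ʳ m n y = refl

  ⁺⁺-YX : ∀ y x → plusplusAdj B (m ↑ʳ y) (x ↑ˡ n) ≡ B x y
  ⁺⁺-YX y x rewrite splitAt-↑ʳ m n y | splitAt-↑ˡ m x n = refl

  ⁺⁺-slashFree : ¬ ContainsSlash B → ¬ ContainsSlash (plusplusAdj B)
  ⁺⁺-slashFree ¬slash (i , j , k , l , i<j , k<l , ik , il , jk , jl)
    with side m n i | side m n k | side m n j | side m n l
  ... | inX x | inX x′ | _ | _ with () ← trans (sym (⁺⁺-XX x x′)) ik
  ... | inY y | inY y′ | _ | _ with () ← trans (sym (⁺⁺-YY y y′)) ik
  ... | _ | _ | inX x | inX x′ with () ← trans (sym (⁺⁺-XX x x′)) jl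
  ... | _ | _ | inY y | inY y′ with () ← trans (sym (⁺⁺-YY y y′)) jl
  ... | inX _ | inY y | inY _ | inX x′ = ↑ʳ≮↑ˡ x′ y k<l
  ... | inY y | inX _ | inX x′ | inY _ = ↑ʳ≮↑ˡ x′ y i<j
  ... | inX x | inY y | inX x′ | inY y′ = ¬slash
    (x , x′ , y , y′ , ↑ˡ-cancel-< i<j , ↑ʳ-cancel-< k<l ,
     trans (sym (⁺⁺-XY x y)) ik , trans (sym (⁺⁺-XY x y′)) il ,
     trans (sym (⁺⁺-XY x′ y)) jk , trans (sym (⁺⁺-XY x′ y′)) jl)
  ... | inY y | inX x | inY y′ | inX x′ = ¬slash
    (x , x′ , y , y′ , ↑ˡ-cancel-< k<l , ↑ʳ-cancel-< i<j ,
     trans (sym (⁺⁺-YX y x)) ik , trans (sym (⁺⁺-YX y′ x)) jk ,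
     trans (sym (⁺⁺-YX y x′)) il , trans (sym (⁺⁺-YX y′ x′)) jl)

blockPerm : Fin m ↔ Fin m → Fin n ↔ Fin n → Fin (m ℕ.+ n) ↔ Fin (m ℕ.+ n)
blockPerm σ τ = ↔-sym +↔⊎ ↔-∘ ((σ ⊎-↔ τ) ↔-∘ +↔⊎)

module _ (σ : Fin m ↔ Fin m) (τ : Fin n ↔ Fin n) where

  blockPerm-X : ∀ x → Inverse.to (blockPerm σ τ) (x ↑ˡ n) ≡ Inverse.to σ x ↑ˡ n
  blockPerm-X x rewrite splitAt-↑ˡ m x n = refl

  blockPerm-Y : ∀ y → Inverse.to (blockPerm σ τ) (m ↑ʳ y) ≡ m ↑ʳ Inverse.to τ y
  blockPerm-Y y rewrite splitAt-↑ʳ m n y = refl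

  permute-⁺⁺ : (B : Bigraph m n) → ∀ a b →
    permute (blockPerm σ τ) (blockPerm σ τ) (plusplusAdj B) a b ≡ plusplusAdj (permute σ τ B) a b
  permute-⁺⁺ B a b with side m n a | side m n b
  ... | inX x | inX x′ rewrite blockPerm-X x | blockPerm-X x′
    = trans (⁺⁺-XX B _ _) (sym (⁺⁺-XX (permute σ τ B) x x′))
  ... | inY y | inY y′ rewrite blockPerm-Y y | blockPerm-Y y′
    = trans (⁺⁺-YY B _ _) (sym (⁺⁺-YY (permute σ τ B) y y′))
  ... | inX x | inY y rewrite blockPerm-X x | blockPerm-Y y
    = trans (⁺⁺-XY B _ _) (sym (⁺⁺-XY (permute σ τ B) x y))
  ... | inY y | inX x rewrite blockPerm-Y y | blockPerm-X x
    = trans (⁺⁺-YX B _ _) (sym (⁺⁺-YX (permute σ τ B) y x))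

cocomparability⇒strong⁺⁺ : (H : Bigraph m n) →
  IsCocomparabilityBigraph H → IsStrongCocomparability (H ⁺⁺)
cocomparability⇒strong⁺⁺ H (σ , τ , ¬slash) = blockPerm σ τ ,
  ⁺⁺-slashFree (permute σ τ H) ¬slash ∘
  submatrix-slash _ _ id id id id (permute-⁺⁺ σ τ H)

strong⁺⁺⇒cocomparability : (H : Bigraph m n) →
  IsStrongCocomparability (H ⁺⁺) → IsCocomparabilityBigraph H
strong⁺⁺⇒cocomparability {m} {n} H (σ , ¬slash) =
  let πX , πX-mono = sortBy posX (↑ˡ-injective n _ _ ∘ from-injective)
      πY , πY-mono = sortBy posY (↑ʳ-injective m _ _ ∘ from-injective)
  in πX , πY ,
     ¬slash ∘ submatrix-slash _ _ (posX ∘ Inverse.to πX) (posY ∘ Inverse.to πY)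
                              πX-mono πY-mono (λ _ _ → sym (entry _ _))
  where
  module σ = Inverse σ

  posX : Fin m → Fin (m ℕ.+ n)
  posX x = σ.from (x ↑ˡ n)

  posY : Fin n → Fin (m ℕ.+ n)
  posY y = σ.from (m ↑ʳ y)

  from-injective : Injective _≡_ _≡_ σ.from
  from-injective = Injection.injective (↔⇒↣ (↔-sym σ))

  entry : ∀ x y → permute σ σ (plusplusAdj H) (posX x) (posY y) ≡ H x y
  entry x y = trans (cong₂ (plusplusAdj H) (σ.strictlyInverseˡ _) (σ.strictlyInverseˡ _))
                    (⁺⁺-XY H x y)

theorem12 : ∀ (m n : ℕ) (H : Bigraph m n) →
    IsCocomparabilityBigraph H ⇔ IsStrongCocomparability (H ⁺⁺)
theorem12 m n H = mk⇔ (cocomparability⇒strong⁺⁺ H) (strong⁺⁺⇒cocomparability H)
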